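{- Every function definable by a monotone register transducer is affine $\lambda_\wp$-definable.
   Context: Copyless monotone register updates: - A copyless monotone register update from $n$ to $k$ registers is a $k$-tuple $(w_0,\dots,w_{k-1})$ of words over $\Gamma\cup\{0,\dots,n-1\}$. - Copylessness: each index $i<n$ occurs at most once overall. - Monotonicity: if $i\le j<n$ occur in $w_{\ell_i}$ and $w_{\ell_j}$ respectively, then either $\ell_i<\ell_j$, or $\ell_i=\ell_j$ and $i$ occurs before $j$. - Composition substitutes, for each index, the corresponding component. Monotone register transducers: - A monotone register transducer has $n$ registers and a copyless monotone update $\sigma_a$ from $n$ to $n$ registers for each $a\in\Sigma$. - It computes $a_1\dots a_m\mapsto$ the content of the first component of $\sigma_{a_m}\circ\dots\circ\sigma_{a_1}\circ\epsilon^n$, where $\epsilon^n$ sets all registers to the empty word. Affine $\lambda_\wp$-definability: - $f:\Sigma^*\to\Gamma^*$ is affine $\lambda_\wp$-definable if there are a purely affine type $\kappa$ and a term $\mathtt{f}:\mathrm{Str}_\Sigma[\kappa]\multimap\mathrm{Str}_\Gamma$ of the planar affine $\lambda$-calculus such that $\mathtt{f}\,\overline{w}=_{\beta\eta}\overline{f(w)}$ for all $w$. - $\mathrm{Str}_\Sigma=(\mathtt{o}\multimap\mathtt{o})\to\dots\to(\mathtt{o}\multimap\mathtt{o})\to\mathtt{o}\to\mathtt{o}$, with $|\Sigma|$ copies, over a base type $\mathtt{o}$. - $\overline{w}$ is the Church encoding. - $\tau[\kappa]$ substitutes $\kappa$ for $\mathtt{o}$. - $\multimap$ is the affine function type, whose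 arguments are used at most once and in order, and $\to$ is the unrestricted one. -}

module Defs where

open import Data.Nat using (ℕ; zero; suc; pred; _∸_; _<ᵇ_; _≡ᵇ_) renaming (_<_ to _<ⁿ_)
open import Data.Bool using (if_then_else_)
open import Data.Fin using (Fin; toℕ) renaming (_<_ to _<ᶠ_; zero to fzero)
open import Data.List using (List; []; _∷_; _++_; foldr; foldl; concatMap; length; lookup; map)
open import Data.List.Relation.Unary.Linked using (Linked)
open import Data.Sum using (_⊎_; inj₁; inj₂)
open import Data.Product using (_×_; Σ; ∃; _,_)
open import Relation.Binary.PropositionalEquality using (_≡_)
open import Relation.Binary.Construct.Closure.Equivalence using (EqClosure)

-- Input alphabet Σ = Fin s, output alphabet Γ = Fin g.
-- An update from n to k registers: a k-tuple (w_0,…,w_{k-1}) of words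
-- over Γ ⊎ {0,…,n-1}.

Update : ℕ → ℕ → ℕ → Set
Update g n k = Fin k → List (Fin g ⊎ Fin n)

Occ : ∀ {g n k} (σ : Update g n k) → Fin n → (ℓ : Fin k) → Fin (length (σ ℓ)) → Set
Occ σ i ℓ p = lookup (σ ℓ) p ≡ inj₂ i

Copyless : ∀ {g n k} → Update g n k → Set
Copyless {g} {n} {k} σ =
  ∀ (i : Fin n) (ℓ ℓ' : Fin k) (p : Fin (length (σ ℓ))) (p' : Fin (length (σ ℓ'))) →
  Occ σ i ℓ p → Occ σ i ℓ' p' → (ℓ ≡ ℓ') × (toℕ p ≡ toℕ p')

Monotone : ∀ {g n k} → Update g n k → Set
Monotone {g} {n} {k} σ =
  ∀ (i j : Fin n) (ℓ ℓ' : Fin k) (p : Fin (length (σ ℓ))) (p' : Fin (length (σ ℓ'))) →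
  i <ᶠ j → Occ σ i ℓ p → Occ σ j ℓ' p' →
  (ℓ <ᶠ ℓ') ⊎ ((ℓ ≡ ℓ') × (toℕ p <ⁿ toℕ p'))

_∘ᵘ_ : ∀ {g n k m} → Update g k m → Update g n k → Update g n m
(σ ∘ᵘ τ) ℓ = concatMap subst₁ (σ ℓ)
  where
  subst₁ : _ → _
  subst₁ (inj₁ c) = inj₁ c ∷ []
  subst₁ (inj₂ i) = τ i

εᵘ : ∀ {g} n → Update g 0 n
εᵘ n ℓ = []

closedWord : ∀ {g} → List (Fin g ⊎ Fin 0) → List (Fin g)
closedWord [] = []
closedWord (inj₁ c ∷ w) = c ∷ closedWord w

-- A monotone register transducer with  suc n  registers (at least one
-- register is needed for "the first component" to exist).
record MRT (s g : ℕ) : Set where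
  field
    n        : ℕ
    upd      : Fin s → Update g (suc n) (suc n)
    copyless : ∀ a → Copyless (upd a)
    monotone : ∀ a → Monotone (upd a)

  run : List (Fin s) → Update g 0 (suc n)
  run w = foldl (λ acc a → upd a ∘ᵘ acc) (εᵘ (suc n)) w

  ⟦_⟧ : List (Fin s) → List (Fin g)
  ⟦ w ⟧ = closedWord (run w fzero)

infixr 5 _⊸_ _⇒_
data Ty : Set where
  o   : Ty
  _⊸_ : Ty → Ty → Ty
  _⇒_ : Ty → Ty → Ty

data PurelyAffine : Ty → Set where
  o-pa : PurelyAffine o
  ⊸-pa : ∀ {A B} → PurelyAffine A → PurelyAffine B → PurelyAffine (A ⊸ B)

_[_]ᵀ : Ty → Ty → Ty
o [ κ ]ᵀ = κ
(A ⊸ B) [ κ ]ᵀ = (A [ κ ]ᵀ) ⊸ (B [ κ ]ᵀ)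
(A ⇒ B) [ κ ]ᵀ = (A [ κ ]ᵀ) ⇒ (B [ κ ]ᵀ)

Str : ℕ → Ty
Str zero = o ⇒ o
Str (suc s) = (o ⊸ o) ⇒ Str s

-- Raw terms, de Bruijn style with two sorts of variables:
-- nv i : i-th unrestricted variable, lv i : i-th affine variable
-- (index 0 = most recently bound of that sort).
infixl 7 _·⊸_ _·⇒_
data Tm : Set where
  nv lv     : ℕ → Tm
  ƛ⊸_ ƛ⇒_   : Tm → Tm
  _·⊸_ _·⇒_ : Tm → Tm → Tm

shiftL : ℕ → Tm → Tm
shiftL c (nv i) = nv i
shiftL c (lv i) = if i <ᵇ c then lv i else lv (suc i)
shiftL c (ƛ⊸ t) = ƛ⊸ shiftL (suc c) t
shiftL c (ƛ⇒ t) = ƛ⇒ shiftL c t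
shiftL c (t ·⊸ u) = shiftL c t ·⊸ shiftL c u
shiftL c (t ·⇒ u) = shiftL c t ·⇒ shiftL c u

shiftN : ℕ → Tm → Tm
shiftN c (nv i) = if i <ᵇ c then nv i else nv (suc i)
shiftN c (lv i) = lv i
shiftN c (ƛ⊸ t) = ƛ⊸ shiftN c t
shiftN c (ƛ⇒ t) = ƛ⇒ shiftN (suc c) t
shiftN c (t ·⊸ u) = shiftN c t ·⊸ shiftN c u
shiftN c (t ·⇒ u) = shiftN c t ·⇒ shiftN c u

substL : ℕ → Tm → Tm → Tm
substL j u (nv i) = nv i
substL j u (lv i) = if i <ᵇ j then lv i else (if i ≡ᵇ j then u else lv (pred i))
substL j u (ƛ⊸ t) = ƛ⊸ substL (suc j) (shiftL 0 u) t
substL j u (ƛ⇒ t) = ƛ⇒ substL j (shiftN 0 u) t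
substL j u (t ·⊸ t') = substL j u t ·⊸ substL j u t'
substL j u (t ·⇒ t') = substL j u t ·⇒ substL j u t'

substN : ℕ → Tm → Tm → Tm
substN j u (nv i) = if i <ᵇ j then nv i else (if i ≡ᵇ j then u else nv (pred i))
substN j u (lv i) = lv i
substN j u (ƛ⊸ t) = ƛ⊸ substN j (shiftL 0 u) t
substN j u (ƛ⇒ t) = ƛ⇒ substN (suc j) (shiftN 0 u) t
substN j u (t ·⊸ t') = substN j u t ·⊸ substN j u t'
substN j u (t ·⇒ t') = substN j u t ·⇒ substN j u t'

infix 4 _↦_
data _↦_ : Tm → Tm → Set where
  β⊸  : ∀ {t u} → (ƛ⊸ t) ·⊸ u ↦ substL 0 u t
  β⇒  : ∀ {t u} → (ƛ⇒ t) ·⇒ u ↦ substN 0 u t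
  η⊸  : ∀ {t} → ƛ⊸ (shiftL 0 t ·⊸ lv 0) ↦ t
  η⇒  : ∀ {t} → ƛ⇒ (shiftN 0 t ·⇒ nv 0) ↦ t
  ξƛ⊸ : ∀ {t t'} → t ↦ t' → ƛ⊸ t ↦ ƛ⊸ t'
  ξƛ⇒ : ∀ {t t'} → t ↦ t' → ƛ⇒ t ↦ ƛ⇒ t'
  ξ⊸ₗ : ∀ {t t' u} → t ↦ t' → t ·⊸ u ↦ t' ·⊸ u
  ξ⊸ᵣ : ∀ {t u u'} → u ↦ u' → t ·⊸ u ↦ t ·⊸ u'
  ξ⇒ₗ : ∀ {t t' u} → t ↦ t' → t ·⇒ u ↦ t' ·⇒ u
  ξ⇒ᵣ : ∀ {t u u'} → u ↦ u' → t ·⇒ u ↦ t ·⇒ u'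

infix 4 _=βη_
_=βη_ : Tm → Tm → Set
_=βη_ = EqClosure _↦_

data _∋_⦂_ : List Ty → ℕ → Ty → Set where
  here  : ∀ {A Γ} → (A ∷ Γ) ∋ zero ⦂ A
  there : ∀ {A B Γ i} → Γ ∋ i ⦂ A → (B ∷ Γ) ∋ suc i ⦂ A

unbind : List ℕ → List ℕ
unbind [] = []
unbind (zero ∷ U) = unbind U
unbind (suc i ∷ U) = i ∷ unbind U

-- Typing  Ψ ∣ Δ ⊢ t ⦂ A ▷ U : Ψ is the unrestricted context, Δ the ordered
-- affine context (both newest-first), and U lists the affine variables
-- used by t in left-to-right order of occurrence.  Planar affine use
-- (each affine variable at most once, and in the order of Δ, i.e. the
-- rules  Ψ;Δ,x:A ⊢ t:B ⟹ Ψ;Δ ⊢ λx.t : A⊸B  and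
-- Ψ;Δ ⊢ t:A⊸B, Ψ;Δ' ⊢ u:A ⟹ Ψ;Δ,Δ' ⊢ t u : B, with weakening) is the
-- requirement that U is strictly decreasing (older variables first).
data _∣_⊢_⦂_▷_ (Ψ Δ : List Ty) : Tm → Ty → List ℕ → Set where
  ⊢nv : ∀ {i A} → Ψ ∋ i ⦂ A → Ψ ∣ Δ ⊢ nv i ⦂ A ▷ []
  ⊢lv : ∀ {i A} → Δ ∋ i ⦂ A → Ψ ∣ Δ ⊢ lv i ⦂ A ▷ (i ∷ [])
  ⊢ƛ⊸ : ∀ {t A B U} → Ψ ∣ (A ∷ Δ) ⊢ t ⦂ B ▷ U → Ψ ∣ Δ ⊢ ƛ⊸ t ⦂ A ⊸ B ▷ unbind U
  ⊢ƛ⇒ : ∀ {t A B U} → (A ∷ Ψ) ∣ Δ ⊢ t ⦂ B ▷ U → Ψ ∣ Δ ⊢ ƛ⇒ t ⦂ A ⇒ B ▷ U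
  ⊢·⊸ : ∀ {t u A B U V} → Ψ ∣ Δ ⊢ t ⦂ A ⊸ B ▷ U → Ψ ∣ Δ ⊢ u ⦂ A ▷ V →
        Linked (λ i j → j <ⁿ i) (U ++ V) → Ψ ∣ Δ ⊢ t ·⊸ u ⦂ B ▷ (U ++ V)
  ⊢·⇒ : ∀ {t u A B U} → Ψ ∣ Δ ⊢ t ⦂ A ⇒ B ▷ U → Ψ ∣ Δ ⊢ u ⦂ A ▷ [] →
        Ψ ∣ Δ ⊢ t ·⇒ u ⦂ B ▷ U

-- Church encoding of a word a_1…a_m over Fin s:
--   λf_0 … f_{s-1}. λx. f_{a_1} (… (f_{a_m} x))
ƛ⇒^ : ℕ → Tm → Tm
ƛ⇒^ zero t = t
ƛ⇒^ (suc k) t = ƛ⇒ (ƛ⇒^ k t)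

church : (s : ℕ) → List (Fin s) → Tm
church s w = ƛ⇒^ (suc s) (foldr (λ a acc → nv (s ∸ toℕ a) ·⊸ acc) (nv 0) w)

AffineDefinable : (s g : ℕ) → (List (Fin s) → List (Fin g)) → Set
AffineDefinable s g f =
  Σ Ty λ κ → PurelyAffine κ × (Σ Tm λ t →
    ([] ∣ [] ⊢ t ⦂ (Str s [ κ ]ᵀ) ⊸ Str g ▷ []) ×
    (∀ (w : List (Fin s)) → (t ·⊸ church s w) =βη church g (f w)))

{-# OPTIONS --safe #-}
-- The Church encoding of the input word is used at type κ = K ⊸ K, where
-- K = (o ⊸ o) ⊸ ⋯ ⊸ (o ⊸ o) ⊸ o is a continuation expecting the n + 1 register contents, each an
-- output word represented as an affine o ⊸ o. Letter a becomes  λX K r₀ … rₙ. X K t₀ … tₙ, where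
-- tℓ is the ℓ-th component of σₐ with register i read as rᵢ: it performs σₐ and hands the new
-- registers to the rest X of the word. Applied to the identity, to K₀ = λr₀ … rₙ. r₀ x and to
-- empty registers, the word thus runs the transducer and returns register 0.  Copylessness makes
-- each rᵢ occur at most once in t₀ … tₙ, and monotonicity makes them occur in the order r₀, …, rₙ
-- in which they are bound, which is exactly planarity.
module Submission where

open import Defs
open import Data.Bool using (true; false; if_then_else_)
open import Data.Empty using (⊥; ⊥-elim)
open import Data.Fin using (Fin; toℕ) renaming (zero to fz; suc to fs; _<_ to _<ᶠ_)
import Data.Fin.Properties as Fin
open import Data.List
  using (List; []; _∷_; _++_; foldr; foldl; map; length; concat; concatMap; allFin; lookup; replicate; tabulate)
open import Data.List.Properties
  using (length-tabulate; ++-assoc; ++-identityʳ; map-∘; map-cong; concat-map; foldr-++)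
open import Data.List.Relation.Unary.All as All using (All; []; _∷_)
import Data.List.Relation.Unary.All.Properties as Allₚ
open import Data.List.Relation.Unary.AllPairs as AllPairs using (AllPairs; []; _∷_)
import Data.List.Relation.Unary.AllPairs.Properties as AllPairsₚ
open import Data.List.Relation.Unary.Linked using ([-]; _∷_)
open import Data.List.Relation.Unary.Linked.Properties using (AllPairs⇒Linked)
open import Data.Maybe using (Maybe; just; nothing)
open import Data.Nat using (ℕ; zero; suc; _+_; _∸_; _<ᵇ_; _≡ᵇ_; _≤_; _<_; _>_; z≤n; s≤s; z<s; s<s)
open import Data.Nat.Properties
open import Data.Product using (_×_; _,_; uncurry)
open import Data.Sum using (_⊎_; inj₁; inj₂; [_,_])
open import Data.Unit using (⊤; tt)
open import Function using (id; _∘_)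
open import Relation.Binary.Construct.Closure.ReflexiveTransitive as Star using (Star; ε; _◅_; _◅◅_)
open import Relation.Binary.Construct.Closure.ReflexiveTransitive.Properties using (module StarReasoning)
open import Relation.Binary.Construct.Closure.Symmetric using (fwd)
open import Relation.Binary.Definitions using (tri<; tri≈; tri>)
open import Relation.Binary.PropositionalEquality hiding ([_])
open import Relation.Nullary.Reflects using (Reflects; ofʸ; ofⁿ; det; fromEquivalence)

infix 4 _↦*_
_↦*_ : Tm → Tm → Set
_↦*_ = Star _↦_

↦*⇒=βη : ∀ {t u} → t ↦* u → t =βη u
↦*⇒=βη = Star.gmap id fwd

≡⇒↦* : ∀ {t u} → t ≡ u → t ↦* u
≡⇒↦* refl = ε

ξ*ƛ⊸ : ∀ {t t'} → t ↦* t' → ƛ⊸ t ↦* ƛ⊸ t'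
ξ*ƛ⊸ = Star.gmap ƛ⊸_ ξƛ⊸

ξ*ƛ⇒ : ∀ {t t'} → t ↦* t' → ƛ⇒ t ↦* ƛ⇒ t'
ξ*ƛ⇒ = Star.gmap ƛ⇒_ ξƛ⇒

ξ*⊸ₗ : ∀ {t t' u} → t ↦* t' → t ·⊸ u ↦* t' ·⊸ u
ξ*⊸ₗ {u = u} = Star.gmap (_·⊸ u) ξ⊸ₗ

ξ*⊸ᵣ : ∀ {t u u'} → u ↦* u' → t ·⊸ u ↦* t ·⊸ u'
ξ*⊸ᵣ {t = t} = Star.gmap (t ·⊸_) ξ⊸ᵣ

ξ*⇒ₗ : ∀ {t t' u} → t ↦* t' → t ·⇒ u ↦* t' ·⇒ u
ξ*⇒ₗ {u = u} = Star.gmap (_·⇒ u) ξ⇒ₗ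

ƛ⊸^ : ℕ → Tm → Tm
ƛ⊸^ zero t = t
ƛ⊸^ (suc k) t = ƛ⊸ (ƛ⊸^ k t)

infixl 7 _·⊸*_ _·⇒*_

_·⊸*_ : Tm → List Tm → Tm
t ·⊸* [] = t
t ·⊸* (u ∷ us) = t ·⊸ u ·⊸* us

_·⇒*_ : ∀ {m} → Tm → (Fin m → Tm) → Tm
_·⇒*_ {zero} t G = t
_·⇒*_ {suc m} t G = t ·⇒ G fz ·⇒* (G ∘ fs)

nest : ∀ {A : Set} → (A → Tm) → List A → Tm → Tm
nest h as z = foldr (λ a t → h a ·⊸ t) z as

-- The variable that the Church encoding over an m-letter alphabet binds to letter c.
letter : ∀ {m} → Fin m → Tm
letter {m} c = nv (m ∸ toℕ c)

ξ*ƛ⇒^ : ∀ k {t t'} → t ↦* t' → ƛ⇒^ k t ↦* ƛ⇒^ k t'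
ξ*ƛ⇒^ zero r = r
ξ*ƛ⇒^ (suc k) r = ξ*ƛ⇒ (ξ*ƛ⇒^ k r)

ξ*·⊸*ₗ : ∀ {t t'} us → t ↦* t' → t ·⊸* us ↦* t' ·⊸* us
ξ*·⊸*ₗ [] r = r
ξ*·⊸*ₗ (u ∷ us) r = ξ*·⊸*ₗ us (ξ*⊸ₗ r)

ξ*·⊸*-map : ∀ {A : Set} {f f' : A → Tm} t xs → (∀ x → f x ↦* f' x) →
            t ·⊸* map f xs ↦* t ·⊸* map f' xs
ξ*·⊸*-map t [] r = ε
ξ*·⊸*-map {f = f} t (x ∷ xs) r = ξ*·⊸*ₗ (map f xs) (ξ*⊸ᵣ (r x)) ◅◅ ξ*·⊸*-map (t ·⊸ _) xs r

ξ*·⇒*ₗ : ∀ {m t t'} (G : Fin m → Tm) → t ↦* t' → t ·⇒* G ↦* t' ·⇒* G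
ξ*·⇒*ₗ {zero} G r = r
ξ*·⇒*ₗ {suc m} G r = ξ*·⇒*ₗ (G ∘ fs) (ξ*⇒ₗ r)

nest-hom : ∀ {A : Set} (f : Tm → Tm) → (∀ t u → f (t ·⊸ u) ≡ f t ·⊸ f u) →
           ∀ (h : A → Tm) as z → f (nest h as z) ≡ nest (f ∘ h) as (f z)
nest-hom f f-· h [] z = refl
nest-hom f f-· h (a ∷ as) z = trans (f-· (h a) (nest h as z)) (cong (f (h a) ·⊸_) (nest-hom f f-· h as z))

nest-cong : ∀ {A : Set} {h h' : A → Tm} → (∀ a → h a ≡ h' a) → ∀ as z → nest h as z ≡ nest h' as z
nest-cong h≗h' [] z = refl
nest-cong h≗h' (a ∷ as) z = cong₂ _·⊸_ (h≗h' a) (nest-cong h≗h' as z)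

nest-++ : ∀ {A : Set} (h : A → Tm) as bs z → nest h (as ++ bs) z ≡ nest h as (nest h bs z)
nest-++ h as bs z = foldr-++ (λ a t → h a ·⊸ t) z as bs

-- Scoping and substitution

<ᵇ-true : ∀ {i j} → i < j → (i <ᵇ j) ≡ true
<ᵇ-true i<j = det (<ᵇ-reflects-< _ _) (ofʸ i<j)

<ᵇ-false : ∀ {i j} → j ≤ i → (i <ᵇ j) ≡ false
<ᵇ-false j≤i = det (<ᵇ-reflects-< _ _) (ofⁿ (≤⇒≯ j≤i))

≡ᵇ-reflects-≡ : ∀ i j → Reflects (i ≡ j) (i ≡ᵇ j)
≡ᵇ-reflects-≡ i j = fromEquivalence (≡ᵇ⇒≡ i j) (≡⇒≡ᵇ i j)

≡ᵇ-true : ∀ i → (i ≡ᵇ i) ≡ true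
≡ᵇ-true i = det (≡ᵇ-reflects-≡ i i) (ofʸ refl)

≡ᵇ-false : ∀ {i j} → i ≢ j → (i ≡ᵇ j) ≡ false
≡ᵇ-false i≢j = det (≡ᵇ-reflects-≡ _ _) (ofⁿ i≢j)

substL-lv≡ : ∀ j u → substL j u (lv j) ≡ u
substL-lv≡ j u rewrite <ᵇ-false {j} ≤-refl | ≡ᵇ-true j = refl

substL-lv< : ∀ {i j} u → i < j → substL j u (lv i) ≡ lv i
substL-lv< u i<j rewrite <ᵇ-true i<j = refl

substN-nv≡ : ∀ j u → substN j u (nv j) ≡ u
substN-nv≡ j u rewrite <ᵇ-false {j} ≤-refl | ≡ᵇ-true j = refl

substN-nv< : ∀ {i j} u → i < j → substN j u (nv i) ≡ nv i
substN-nv< u i<j rewrite <ᵇ-true i<j = refl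

data LvBelow : ℕ → Tm → Set where
  nvᴸ : ∀ {b i} → LvBelow b (nv i)
  lvᴸ : ∀ {b i} → i < b → LvBelow b (lv i)
  ƛ⊸ᴸ : ∀ {b t} → LvBelow (suc b) t → LvBelow b (ƛ⊸ t)
  ƛ⇒ᴸ : ∀ {b t} → LvBelow b t → LvBelow b (ƛ⇒ t)
  _·⊸ᴸ_ : ∀ {b t u} → LvBelow b t → LvBelow b u → LvBelow b (t ·⊸ u)
  _·⇒ᴸ_ : ∀ {b t u} → LvBelow b t → LvBelow b u → LvBelow b (t ·⇒ u)

data NvBelow : ℕ → Tm → Set where
  nvᴺ : ∀ {a i} → i < a → NvBelow a (nv i)
  lvᴺ : ∀ {a i} → NvBelow a (lv i)
  ƛ⊸ᴺ : ∀ {a t} → NvBelow a t → NvBelow a (ƛ⊸ t)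
  ƛ⇒ᴺ : ∀ {a t} → NvBelow (suc a) t → NvBelow a (ƛ⇒ t)
  _·⊸ᴺ_ : ∀ {a t u} → NvBelow a t → NvBelow a u → NvBelow a (t ·⊸ u)
  _·⇒ᴺ_ : ∀ {a t u} → NvBelow a t → NvBelow a u → NvBelow a (t ·⇒ u)

LvBelow-mono : ∀ {b b' t} → b ≤ b' → LvBelow b t → LvBelow b' t
LvBelow-mono b≤b' nvᴸ = nvᴸ
LvBelow-mono b≤b' (lvᴸ i<b) = lvᴸ (<-≤-trans i<b b≤b')
LvBelow-mono b≤b' (ƛ⊸ᴸ t) = ƛ⊸ᴸ (LvBelow-mono (s≤s b≤b') t)
LvBelow-mono b≤b' (ƛ⇒ᴸ t) = ƛ⇒ᴸ (LvBelow-mono b≤b' t)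
LvBelow-mono b≤b' (t ·⊸ᴸ u) = LvBelow-mono b≤b' t ·⊸ᴸ LvBelow-mono b≤b' u
LvBelow-mono b≤b' (t ·⇒ᴸ u) = LvBelow-mono b≤b' t ·⇒ᴸ LvBelow-mono b≤b' u

LvBelow-ƛ⊸^ : ∀ k {b t} → LvBelow (b + k) t → LvBelow b (ƛ⊸^ k t)
LvBelow-ƛ⊸^ zero {b} {t} t< = subst (λ c → LvBelow c t) (+-identityʳ b) t<
LvBelow-ƛ⊸^ (suc k) {b} {t} t< = ƛ⊸ᴸ (LvBelow-ƛ⊸^ k (subst (λ c → LvBelow c t) (+-suc b k) t<))

LvBelow-·⊸* : ∀ {b t us} → LvBelow b t → All (LvBelow b) us → LvBelow b (t ·⊸* us)
LvBelow-·⊸* t [] = t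
LvBelow-·⊸* t (u ∷ us) = LvBelow-·⊸* (t ·⊸ᴸ u) us

LvBelow-nest : ∀ {A : Set} {b} {h : A → Tm} {z} → (∀ a → LvBelow b (h a)) → LvBelow b z →
               ∀ as → LvBelow b (nest h as z)
LvBelow-nest h z [] = z
LvBelow-nest h z (a ∷ as) = h a ·⊸ᴸ LvBelow-nest h z as

NvBelow-ƛ⇒^ : ∀ k {a t} → NvBelow (k + a) t → NvBelow a (ƛ⇒^ k t)
NvBelow-ƛ⇒^ zero t = t
NvBelow-ƛ⇒^ (suc k) {a} {t} t< = ƛ⇒ᴺ (NvBelow-ƛ⇒^ k (subst (λ c → NvBelow c t) (sym (+-suc k a)) t<))

church-closed : ∀ s w → NvBelow 0 (church s w)
church-closed s w =
  NvBelow-ƛ⇒^ (suc s) (subst (λ c → NvBelow c (nest letter w (nv 0))) (sym (+-identityʳ (suc s))) (body w))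
  where
  body : ∀ w → NvBelow (suc s) (nest letter w (nv 0))
  body [] = nvᴺ z<s
  body (a ∷ w) = nvᴺ (s≤s (m∸n≤m s (toℕ a))) ·⊸ᴺ body w

shiftL-LvBelow : ∀ {b t} c → b ≤ c → LvBelow b t → shiftL c t ≡ t
shiftL-LvBelow c b≤c nvᴸ = refl
shiftL-LvBelow c b≤c (lvᴸ i<b) rewrite <ᵇ-true (<-≤-trans i<b b≤c) = refl
shiftL-LvBelow c b≤c (ƛ⊸ᴸ t) = cong ƛ⊸_ (shiftL-LvBelow (suc c) (s≤s b≤c) t)
shiftL-LvBelow c b≤c (ƛ⇒ᴸ t) = cong ƛ⇒_ (shiftL-LvBelow c b≤c t)
shiftL-LvBelow c b≤c (t ·⊸ᴸ u) = cong₂ _·⊸_ (shiftL-LvBelow c b≤c t) (shiftL-LvBelow c b≤c u)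
shiftL-LvBelow c b≤c (t ·⇒ᴸ u) = cong₂ _·⇒_ (shiftL-LvBelow c b≤c t) (shiftL-LvBelow c b≤c u)

shiftN-NvBelow : ∀ {a t} c → a ≤ c → NvBelow a t → shiftN c t ≡ t
shiftN-NvBelow c a≤c (nvᴺ i<a) rewrite <ᵇ-true (<-≤-trans i<a a≤c) = refl
shiftN-NvBelow c a≤c lvᴺ = refl
shiftN-NvBelow c a≤c (ƛ⊸ᴺ t) = cong ƛ⊸_ (shiftN-NvBelow c a≤c t)
shiftN-NvBelow c a≤c (ƛ⇒ᴺ t) = cong ƛ⇒_ (shiftN-NvBelow (suc c) (s≤s a≤c) t)
shiftN-NvBelow c a≤c (t ·⊸ᴺ u) = cong₂ _·⊸_ (shiftN-NvBelow c a≤c t) (shiftN-NvBelow c a≤c u)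
shiftN-NvBelow c a≤c (t ·⇒ᴺ u) = cong₂ _·⇒_ (shiftN-NvBelow c a≤c t) (shiftN-NvBelow c a≤c u)

substL-LvBelow : ∀ {b t} j u → b ≤ j → LvBelow b t → substL j u t ≡ t
substL-LvBelow j u b≤j nvᴸ = refl
substL-LvBelow j u b≤j (lvᴸ i<b) = substL-lv< u (<-≤-trans i<b b≤j)
substL-LvBelow j u b≤j (ƛ⊸ᴸ t) = cong ƛ⊸_ (substL-LvBelow (suc j) _ (s≤s b≤j) t)
substL-LvBelow j u b≤j (ƛ⇒ᴸ t) = cong ƛ⇒_ (substL-LvBelow j _ b≤j t)
substL-LvBelow j u b≤j (t ·⊸ᴸ t') = cong₂ _·⊸_ (substL-LvBelow j u b≤j t) (substL-LvBelow j u b≤j t')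
substL-LvBelow j u b≤j (t ·⇒ᴸ t') = cong₂ _·⇒_ (substL-LvBelow j u b≤j t) (substL-LvBelow j u b≤j t')

map-substL-LvBelow : ∀ {b} j u {ts} → b ≤ j → All (LvBelow b) ts → map (substL j u) ts ≡ ts
map-substL-LvBelow j u b≤j [] = refl
map-substL-LvBelow j u b≤j (t ∷ ts) = cong₂ _∷_ (substL-LvBelow j u b≤j t) (map-substL-LvBelow j u b≤j ts)

substL-ƛ⊸^ : ∀ k j {u} B → LvBelow 0 u → substL j u (ƛ⊸^ k B) ≡ ƛ⊸^ k (substL (j + k) u B)
substL-ƛ⊸^ zero j B u = cong (λ i → substL i _ B) (sym (+-identityʳ j))
substL-ƛ⊸^ (suc k) j B u
  rewrite shiftL-LvBelow 0 z≤n u | substL-ƛ⊸^ k (suc j) B u | +-suc j k = refl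

substL-ƛ⇒^ : ∀ k j {u} B → NvBelow 0 u → substL j u (ƛ⇒^ k B) ≡ ƛ⇒^ k (substL j u B)
substL-ƛ⇒^ zero j B u = refl
substL-ƛ⇒^ (suc k) j B u rewrite shiftN-NvBelow 0 z≤n u | substL-ƛ⇒^ k j B u = refl

substL-·⊸* : ∀ j u t ts → substL j u (t ·⊸* ts) ≡ substL j u t ·⊸* map (substL j u) ts
substL-·⊸* j u t [] = refl
substL-·⊸* j u t (t' ∷ ts) = substL-·⊸* j u (t ·⊸ t') ts

substL-·⇒* : ∀ {m} j u t (G : Fin m → Tm) → (∀ k → LvBelow 0 (G k)) →
             substL j u (t ·⇒* G) ≡ substL j u t ·⇒* G
substL-·⇒* {zero} j u t G G-closed = refl
substL-·⇒* {suc m} j u t G G-closed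
  rewrite substL-·⇒* j u (t ·⇒ G fz) (G ∘ fs) (G-closed ∘ fs) | substL-LvBelow j u z≤n (G-closed fz) = refl

-- Church encodings applied to ⇒-free terms

data ⇒Free : Tm → Set where
  nvᶠ : ∀ {i} → ⇒Free (nv i)
  lvᶠ : ∀ {i} → ⇒Free (lv i)
  ƛ⊸ᶠ : ∀ {t} → ⇒Free t → ⇒Free (ƛ⊸ t)
  _·⊸ᶠ_ : ∀ {t u} → ⇒Free t → ⇒Free u → ⇒Free (t ·⊸ u)

⇒Free-ƛ⊸^ : ∀ k {t} → ⇒Free t → ⇒Free (ƛ⊸^ k t)
⇒Free-ƛ⊸^ zero t = t
⇒Free-ƛ⊸^ (suc k) t = ƛ⊸ᶠ (⇒Free-ƛ⊸^ k t)

⇒Free-·⊸* : ∀ {t us} → ⇒Free t → All ⇒Free us → ⇒Free (t ·⊸* us)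
⇒Free-·⊸* t [] = t
⇒Free-·⊸* t (u ∷ us) = ⇒Free-·⊸* (t ·⊸ᶠ u) us

⇒Free-nest : ∀ {A : Set} {h : A → Tm} {z} → (∀ a → ⇒Free (h a)) → ⇒Free z →
             ∀ as → ⇒Free (nest h as z)
⇒Free-nest h z [] = z
⇒Free-nest h z (a ∷ as) = h a ·⊸ᶠ ⇒Free-nest h z as

-- Meaningful only on ⇒Free terms: it ignores the binders ƛ⇒.
renameN : (ℕ → ℕ) → Tm → Tm
renameN f (nv i) = nv (f i)
renameN f (lv i) = lv i
renameN f (ƛ⊸ t) = ƛ⊸ renameN f t
renameN f (ƛ⇒ t) = ƛ⇒ renameN f t
renameN f (t ·⊸ u) = renameN f t ·⊸ renameN f u
renameN f (t ·⇒ u) = renameN f t ·⇒ renameN f u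

renameN-⇒Free : ∀ f {t} → ⇒Free t → ⇒Free (renameN f t)
renameN-⇒Free f nvᶠ = nvᶠ
renameN-⇒Free f lvᶠ = lvᶠ
renameN-⇒Free f (ƛ⊸ᶠ t) = ƛ⊸ᶠ (renameN-⇒Free f t)
renameN-⇒Free f (t ·⊸ᶠ u) = renameN-⇒Free f t ·⊸ᶠ renameN-⇒Free f u

renameN-cong : ∀ {f f' t} → (∀ i → f i ≡ f' i) → ⇒Free t → renameN f t ≡ renameN f' t
renameN-cong f≗f' (nvᶠ {i}) = cong nv (f≗f' i)
renameN-cong f≗f' lvᶠ = refl
renameN-cong f≗f' (ƛ⊸ᶠ t) = cong ƛ⊸_ (renameN-cong f≗f' t)
renameN-cong f≗f' (t ·⊸ᶠ u) = cong₂ _·⊸_ (renameN-cong f≗f' t) (renameN-cong f≗f' u)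

renameN-id : ∀ {t} → ⇒Free t → renameN id t ≡ t
renameN-id nvᶠ = refl
renameN-id lvᶠ = refl
renameN-id (ƛ⊸ᶠ t) = cong ƛ⊸_ (renameN-id t)
renameN-id (t ·⊸ᶠ u) = cong₂ _·⊸_ (renameN-id t) (renameN-id u)

renameN-∘ : ∀ f f' {t} → ⇒Free t → renameN f (renameN f' t) ≡ renameN (f ∘ f') t
renameN-∘ f f' nvᶠ = refl
renameN-∘ f f' lvᶠ = refl
renameN-∘ f f' (ƛ⊸ᶠ t) = cong ƛ⊸_ (renameN-∘ f f' t)
renameN-∘ f f' (t ·⊸ᶠ u) = cong₂ _·⊸_ (renameN-∘ f f' t) (renameN-∘ f f' u)

shiftN-0≡renameN-suc : ∀ {t} → ⇒Free t → shiftN 0 t ≡ renameN suc t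
shiftN-0≡renameN-suc nvᶠ = refl
shiftN-0≡renameN-suc lvᶠ = refl
shiftN-0≡renameN-suc (ƛ⊸ᶠ t) = cong ƛ⊸_ (shiftN-0≡renameN-suc t)
shiftN-0≡renameN-suc (t ·⊸ᶠ u) = cong₂ _·⊸_ (shiftN-0≡renameN-suc t) (shiftN-0≡renameN-suc u)

substN-renameN-suc+ : ∀ j k u {t} → j ≤ k → ⇒Free t →
                      substN j u (renameN (suc k +_) t) ≡ renameN (k +_) t
substN-renameN-suc+ j k u j≤k (nvᶠ {i})
  rewrite <ᵇ-false {suc k + i} {j} (≤-trans j≤k (≤-trans (m≤m+n k i) (n≤1+n _)))
        | ≡ᵇ-false {suc k + i} {j} (λ i≡j → <⇒≱ (s≤s (≤-trans j≤k (m≤m+n k i))) (≤-reflexive i≡j))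
        = refl
substN-renameN-suc+ j k u j≤k lvᶠ = refl
substN-renameN-suc+ j k u j≤k (ƛ⊸ᶠ t) = cong ƛ⊸_ (substN-renameN-suc+ j k _ j≤k t)
substN-renameN-suc+ j k u j≤k (t ·⊸ᶠ t') =
  cong₂ _·⊸_ (substN-renameN-suc+ j k u j≤k t) (substN-renameN-suc+ j k u j≤k t')

substN-ƛ⇒^ : ∀ k j {u} B → ⇒Free u →
             substN j u (ƛ⇒^ k B) ≡ ƛ⇒^ k (substN (j + k) (renameN (k +_) u) B)
substN-ƛ⇒^ zero j {u} B u-free = cong₂ (λ i t → substN i t B) (sym (+-identityʳ j)) (sym (renameN-id u-free))
substN-ƛ⇒^ (suc k) j {u} B u-free
  rewrite shiftN-0≡renameN-suc u-free
        | substN-ƛ⇒^ k (suc j) B (renameN-⇒Free suc u-free)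
        | renameN-∘ (k +_) suc u-free
        | renameN-cong {f = (k +_) ∘ suc} (λ i → +-suc k i) u-free
        | +-suc j k = refl

-- While m letter binders (and the base binder) of a Church encoding remain, the head of letter a
-- is either still the variable of the j-th remaining binder, or H a, already substituted and
-- shifted past the m + 1 binders that remain.
module ChurchApplication {s : ℕ} (H : Fin s → Tm) (H-free : ∀ a → ⇒Free (H a)) where

  headAt : ∀ m → Fin s → Maybe (Fin m) → Tm
  headAt m a (just j) = nv (m ∸ toℕ j)
  headAt m a nothing = renameN (suc m +_) (H a)

  Pending : ∀ {m} → (Fin m → Tm) → Fin s → Maybe (Fin m) → Set
  Pending G a (just j) = G j ≡ H a
  Pending G a nothing = ⊤

  advance : ∀ {m} → Maybe (Fin (suc m)) → Maybe (Fin m)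
  advance (just fz) = nothing
  advance (just (fs j)) = just j
  advance nothing = nothing

  advance-Pending : ∀ {m} (G : Fin (suc m) → Tm) a c → Pending G a c → Pending (G ∘ fs) a (advance c)
  advance-Pending G a (just fz) _ = tt
  advance-Pending G a (just (fs j)) Gj≡Ha = Gj≡Ha
  advance-Pending G a nothing _ = tt

  substN-headAt : ∀ m (G : Fin (suc m) → Tm) a c → Pending G a c →
    substN (suc m) (renameN (suc m +_) (G fz)) (headAt (suc m) a c) ≡ headAt m a (advance c)
  substN-headAt m G a (just fz) G0≡Ha = trans (substN-nv≡ (suc m) _) (cong (renameN (suc m +_)) G0≡Ha)
  substN-headAt m G a (just (fs j)) _ = substN-nv< _ (s≤s (m∸n≤m m (toℕ j)))
  substN-headAt m G a nothing _ = substN-renameN-suc+ (suc m) (suc m) _ ≤-refl (H-free a)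

  substN-headAt-last : ∀ z a (c : Maybe (Fin 0)) → substN 0 z (headAt 0 a c) ≡ H a
  substN-headAt-last z a nothing = trans (substN-renameN-suc+ 0 0 z z≤n (H-free a)) (renameN-id (H-free a))

  partial-application-β : ∀ m (G : Fin m → Tm) (c : Fin s → Maybe (Fin m)) →
    (∀ j → ⇒Free (G j)) → (∀ a → Pending G a (c a)) → ∀ w z →
    ƛ⇒^ (suc m) (nest (λ a → headAt m a (c a)) w (nv 0)) ·⇒* G ·⇒ z ↦* nest H w z
  partial-application-β zero G c G-free pending w z =
    β⇒ ◅ ≡⇒↦* (trans (nest-hom (substN 0 z) (λ _ _ → refl) _ w (nv 0))
                     (nest-cong (λ a → substN-headAt-last z a (c a)) w z))
  partial-application-β (suc m) G c G-free pending w z =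
    ξ*⇒ₗ (ξ*·⇒*ₗ (G ∘ fs) (β⇒ ◅ ≡⇒↦* substituted))
    ◅◅ partial-application-β m (G ∘ fs) (advance ∘ c) (G-free ∘ fs)
                             (λ a → advance-Pending G a (c a) (pending a)) w z
    where
    substituted : substN 0 (G fz) (ƛ⇒^ (suc m) (nest (λ a → headAt (suc m) a (c a)) w (nv 0)))
                ≡ ƛ⇒^ (suc m) (nest (λ a → headAt m a (advance (c a))) w (nv 0))
    substituted = trans (substN-ƛ⇒^ (suc m) 0 _ (G-free fz))
      (cong (ƛ⇒^ (suc m)) (trans (nest-hom (substN (suc m) _) (λ _ _ → refl) _ w (nv 0))
        (nest-cong (λ a → substN-headAt m G a (c a) (pending a)) w (nv 0))))

  church-·⇒*-β : ∀ w z → church s w ·⇒* H ·⇒ z ↦* nest H w z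
  church-·⇒*-β = partial-application-β s H just H-free (λ _ → refl)

-- Registers of copyless monotone updates

registers : ∀ {g n} → List (Fin g ⊎ Fin n) → List (Fin n)
registers [] = []
registers (inj₁ _ ∷ w) = registers w
registers (inj₂ i ∷ w) = i ∷ registers w

registers-All : ∀ {g n} {P : Fin n → Set} (w : List (Fin g ⊎ Fin n)) →
  (∀ p {i} → lookup w p ≡ inj₂ i → P i) → All P (registers w)
registers-All [] P-occ = []
registers-All (inj₁ _ ∷ w) P-occ = registers-All w (P-occ ∘ fs)
registers-All (inj₂ i ∷ w) P-occ = P-occ fz refl ∷ registers-All w (P-occ ∘ fs)

registers-AllPairs : ∀ {g n} {R : Fin n → Fin n → Set} (w : List (Fin g ⊎ Fin n)) →
  (∀ p p' {i j} → toℕ p < toℕ p' → lookup w p ≡ inj₂ i → lookup w p' ≡ inj₂ j → R i j) →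
  AllPairs R (registers w)
registers-AllPairs [] R-occ = []
registers-AllPairs (inj₁ _ ∷ w) R-occ = registers-AllPairs w (λ p p' p<p' → R-occ (fs p) (fs p') (s<s p<p'))
registers-AllPairs (inj₂ i ∷ w) R-occ =
  registers-All w (λ p' → R-occ fz (fs p') z<s refl)
  ∷ registers-AllPairs w (λ p p' p<p' → R-occ (fs p) (fs p') (s<s p<p'))

LexBefore : ∀ {k} → Fin k → ℕ → Fin k → ℕ → Set
LexBefore ℓ p ℓ' p' = ℓ <ᶠ ℓ' ⊎ (ℓ ≡ ℓ' × p < p')

LexBefore-irrefl : ∀ {k} {ℓ ℓ' : Fin k} {p p'} → ℓ ≡ ℓ' → p ≡ p' → LexBefore ℓ p ℓ' p' → ⊥
LexBefore-irrefl refl _ (inj₁ ℓ<ℓ) = <-irrefl refl ℓ<ℓ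
LexBefore-irrefl _ p≡p' (inj₂ (_ , p<p')) = <-irrefl p≡p' p<p'

LexBefore-asym : ∀ {k} {ℓ ℓ' : Fin k} {p p'} → LexBefore ℓ p ℓ' p' → LexBefore ℓ' p' ℓ p → ⊥
LexBefore-asym (inj₁ ℓ<ℓ') (inj₁ ℓ'<ℓ) = <-asym ℓ<ℓ' ℓ'<ℓ
LexBefore-asym (inj₁ ℓ<ℓ') (inj₂ (refl , _)) = <-irrefl refl ℓ<ℓ'
LexBefore-asym (inj₂ (refl , _)) (inj₁ ℓ'<ℓ) = <-irrefl refl ℓ'<ℓ
LexBefore-asym (inj₂ (_ , p<p')) (inj₂ (_ , p'<p)) = <-asym p<p' p'<p

module RegisterOrder {g n k} (σ : Update g n k) (copyless : Copyless σ) (monotone : Monotone σ) where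

  occurrences-increasing : ∀ {i j ℓ ℓ'} (p : Fin (length (σ ℓ))) (p' : Fin (length (σ ℓ'))) →
    LexBefore ℓ (toℕ p) ℓ' (toℕ p') → Occ σ i ℓ p → Occ σ j ℓ' p' → i <ᶠ j
  occurrences-increasing {i} {j} {ℓ} {ℓ'} p p' before occ occ' with Fin.<-cmp i j
  ... | tri< i<j _ _ = i<j
  ... | tri≈ _ refl _ = ⊥-elim (uncurry LexBefore-irrefl (copyless i ℓ ℓ' p p' occ occ') before)
  ... | tri> _ _ j<i = ⊥-elim (LexBefore-asym before (monotone j i ℓ' ℓ p' p j<i occ' occ))

  registers-increasing : ∀ ℓ → AllPairs _<ᶠ_ (registers (σ ℓ))
  registers-increasing ℓ =
    registers-AllPairs (σ ℓ) (λ p p' p<p' → occurrences-increasing p p' (inj₂ (refl , p<p')))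

  registers-ordered : ∀ {ℓ ℓ'} → ℓ <ᶠ ℓ' →
                      All (λ i → All (i <ᶠ_) (registers (σ ℓ'))) (registers (σ ℓ))
  registers-ordered ℓ<ℓ' = registers-All (σ _) (λ p occ →
    registers-All (σ _) (λ p' occ' → occurrences-increasing p p' (inj₁ ℓ<ℓ') occ occ'))

  all-registers-increasing : AllPairs _<ᶠ_ (concatMap (registers ∘ σ) (allFin k))
  all-registers-increasing = AllPairsₚ.concat⁺
    (Allₚ.map⁺ (All.universal registers-increasing (allFin k)))
    (AllPairsₚ.map⁺ (AllPairsₚ.tabulate⁺-< registers-ordered))

instantiate : ∀ {g n} → (Fin n → List (Fin g)) → List (Fin g ⊎ Fin n) → List (Fin g)
instantiate c = concatMap [ (_∷ []) , c ]

closedWord-++ : ∀ {g} (xs ys : List (Fin g ⊎ Fin 0)) → closedWord (xs ++ ys) ≡ closedWord xs ++ closedWord ys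
closedWord-++ [] ys = refl
closedWord-++ (inj₁ c ∷ xs) ys = cong (c ∷_) (closedWord-++ xs ys)

closedWord-∘ᵘ : ∀ {g n k} (σ : Update g n k) (τ : Update g 0 n) ℓ →
  closedWord ((σ ∘ᵘ τ) ℓ) ≡ instantiate (closedWord ∘ τ) (σ ℓ)
closedWord-∘ᵘ {g} {n} σ τ ℓ = closedWord-concatMap _ (λ _ → refl) (λ _ → refl) (σ ℓ)
  where
  -- the substitution inside _∘ᵘ_ is local to its definition, so it is known only by its equations
  closedWord-concatMap : (f : Fin g ⊎ Fin n → List (Fin g ⊎ Fin 0)) →
    (∀ c → f (inj₁ c) ≡ inj₁ c ∷ []) → (∀ i → f (inj₂ i) ≡ τ i) →
    ∀ xs → closedWord (concatMap f xs) ≡ instantiate (closedWord ∘ τ) xs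
  closedWord-concatMap f f-letter f-register [] = refl
  closedWord-concatMap f f-letter f-register (x ∷ xs) =
    trans (closedWord-++ (f x) (concatMap f xs))
          (cong₂ _++_ (closedWord-f x) (closedWord-concatMap f f-letter f-register xs))
    where
    closedWord-f : ∀ x → closedWord (f x) ≡ [ (_∷ []) , closedWord ∘ τ ] x
    closedWord-f (inj₁ c) = cong closedWord (f-letter c)
    closedWord-f (inj₂ i) = cong closedWord (f-register i)

-- Typing

Endo : Ty
Endo = o ⊸ o

endos : ℕ → Ty → Ty
endos zero B = B
endos (suc m) B = Endo ⊸ endos m B

PurelyAffine-endos : ∀ m {B} → PurelyAffine B → PurelyAffine (endos m B)
PurelyAffine-endos zero B = B
PurelyAffine-endos (suc m) B = ⊸-pa (⊸-pa o-pa o-pa) (PurelyAffine-endos m B)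

∋-replicate : ∀ m {k A Γ} → k < m → (replicate m A ++ Γ) ∋ k ⦂ A
∋-replicate (suc m) {zero} _ = here
∋-replicate (suc m) {suc k} (s<s k<m) = there (∋-replicate m k<m)

∋-replicate-++ : ∀ m {k A B Γ} → Γ ∋ k ⦂ B → (replicate m A ++ Γ) ∋ k + m ⦂ B
∋-replicate-++ zero {k} {B = B} {Γ} x = subst (λ i → Γ ∋ i ⦂ B) (sym (+-identityʳ k)) x
∋-replicate-++ (suc m) {k} {A} {B} {Γ} x =
  subst (λ i → (replicate (suc m) A ++ Γ) ∋ i ⦂ B) (sym (+-suc k m)) (there (∋-replicate-++ m x))

replicate-++-∷ : ∀ m (A : Ty) Γ → replicate m A ++ A ∷ Γ ≡ A ∷ replicate m A ++ Γ
replicate-++-∷ zero A Γ = refl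
replicate-++-∷ (suc m) A Γ = cong (A ∷_) (replicate-++-∷ m A Γ)

Decreasing : List ℕ → Set
Decreasing = AllPairs _>_

AllPairs-++⁻ˡ : ∀ {A : Set} {R : A → A → Set} xs {ys} → AllPairs R (xs ++ ys) → AllPairs R xs
AllPairs-++⁻ˡ [] _ = []
AllPairs-++⁻ˡ (x ∷ xs) (px ∷ pxs) = Allₚ.++⁻ˡ xs px ∷ AllPairs-++⁻ˡ xs pxs

unbind-suc-0 : ∀ U → unbind (map suc U ++ (0 ∷ [])) ≡ U
unbind-suc-0 [] = refl
unbind-suc-0 (i ∷ U) = cong (i ∷_) (unbind-suc-0 U)

Decreasing-suc-0 : ∀ {U} → Decreasing U → Decreasing (map suc U ++ (0 ∷ []))
Decreasing-suc-0 [] = [] ∷ []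
Decreasing-suc-0 (h ∷ hs) = Allₚ.++⁺ (Allₚ.map⁺ (All.map s<s h)) (z<s ∷ []) ∷ Decreasing-suc-0 hs

unbind^ : ℕ → List ℕ → List ℕ
unbind^ zero U = U
unbind^ (suc m) U = unbind (unbind^ m U)

unbind-All< : ∀ {k U} → All (_< suc k) U → All (_< k) (unbind U)
unbind-All< [] = []
unbind-All< {U = zero ∷ U} (_ ∷ U<) = unbind-All< U<
unbind-All< {U = suc i ∷ U} (s<s i<k ∷ U<) = i<k ∷ unbind-All< U<

unbind^-All< : ∀ m {k U} → All (_< k + m) U → All (_< k) (unbind^ m U)
unbind^-All< zero {k} U< = All.map (λ {i} → subst (i <_) (+-identityʳ k)) U<
unbind^-All< (suc m) {k} U< = unbind-All< (unbind^-All< m (All.map (λ {i} → subst (i <_) (+-suc k m)) U<))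

unbind^-[] : ∀ m {U} → All (_< m) U → unbind^ m U ≡ []
unbind^-[] m U< = none<0 (unbind^-All< m {0} U<)
  where
  none<0 : ∀ {U} → All (_< 0) U → U ≡ []
  none<0 [] = refl

⊢-cast▷ : ∀ {Ψ Δ t A U U'} → U ≡ U' → Ψ ∣ Δ ⊢ t ⦂ A ▷ U → Ψ ∣ Δ ⊢ t ⦂ A ▷ U'
⊢-cast▷ refl d = d

⊢ƛ⊸^ : ∀ m {Ψ Δ B C U} → Ψ ∣ (replicate m Endo ++ Δ) ⊢ B ⦂ C ▷ U →
       Ψ ∣ Δ ⊢ ƛ⊸^ m B ⦂ endos m C ▷ unbind^ m U
⊢ƛ⊸^ zero d = d
⊢ƛ⊸^ (suc m) {Ψ} {Δ} {B} {C} {U} d =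
  ⊢ƛ⊸ (⊢ƛ⊸^ m (subst (λ Δ' → Ψ ∣ Δ' ⊢ B ⦂ C ▷ U) (sym (replicate-++-∷ m Endo Δ)) d))

⊢ƛ⇒^ : ∀ m Ψ {Δ M U} → (o ∷ replicate m Endo ++ Ψ) ∣ Δ ⊢ M ⦂ o ▷ U →
       Ψ ∣ Δ ⊢ ƛ⇒^ (suc m) M ⦂ Str m ▷ U
⊢ƛ⇒^ zero Ψ d = ⊢ƛ⇒ d
⊢ƛ⇒^ (suc m) Ψ {Δ} {M} {U} d =
  ⊢ƛ⇒ (⊢ƛ⇒^ m (Endo ∷ Ψ)
    (subst (λ Ψ' → Ψ' ∣ Δ ⊢ M ⦂ o ▷ U) (cong (o ∷_) (sym (replicate-++-∷ m Endo Ψ))) d))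

⊢·⊸*-map : ∀ {A : Set} {Ψ Δ t m C U} (f : A → Tm) (u : A → List ℕ) xs → length xs ≡ m →
  Ψ ∣ Δ ⊢ t ⦂ endos m C ▷ U → (∀ x → Ψ ∣ Δ ⊢ f x ⦂ Endo ▷ u x) →
  Decreasing (U ++ concatMap u xs) →
  Ψ ∣ Δ ⊢ t ·⊸* map f xs ⦂ C ▷ (U ++ concatMap u xs)
⊢·⊸*-map {U = U} f u [] refl dt df _ = ⊢-cast▷ (sym (++-identityʳ U)) dt
⊢·⊸*-map {U = U} f u (x ∷ xs) refl dt df dec =
  ⊢-cast▷ (++-assoc U (u x) (concatMap u xs))
    (⊢·⊸*-map f u xs refl (⊢·⊸ dt (df x) (AllPairs⇒Linked (AllPairs-++⁻ˡ (U ++ u x) dec'))) df dec')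
  where
  dec' : Decreasing ((U ++ u x) ++ concatMap u xs)
  dec' = subst Decreasing (sym (++-assoc U (u x) (concatMap u xs))) dec

⊢·⇒* : ∀ {m Ψ Δ t U} κ (G : Fin m → Tm) → Ψ ∣ Δ ⊢ t ⦂ Str m [ κ ]ᵀ ▷ U →
  (∀ j → Ψ ∣ Δ ⊢ G j ⦂ κ ⊸ κ ▷ []) → Ψ ∣ Δ ⊢ t ·⇒* G ⦂ κ ⇒ κ ▷ U
⊢·⇒* {zero} κ G dt dG = dt
⊢·⇒* {suc m} κ G dt dG = ⊢·⇒* κ (G ∘ fs) (⊢·⇒ dt (dG fz)) (dG ∘ fs)

-- Simulating a monotone register transducer

module Encoding {s g : ℕ} (T : MRT s g) where
  open MRT T
  open ChurchApplication using (church-·⇒*-β)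

  N : ℕ
  N = suc n

  -- Under the N affine binders r₀ … rₙ of the registers, rᵢ is the de Bruijn index n ∸ i.
  regIndex : Fin N → ℕ
  regIndex i = n ∸ toℕ i

  regVar : ℕ → Fin N → Tm
  regVar d i = lv (d + regIndex i)

  wordTm : List (Fin g) → Tm
  wordTm u = ƛ⊸ nest letter u (lv 0)

  regTm : Update g 0 N → Fin N → Tm
  regTm τ i = wordTm (closedWord (τ i))

  encode : Update g 0 N → List Tm
  encode τ = map (regTm τ) (allFin N)

  template : (Fin N → Tm) → List (Fin g ⊎ Fin N) → Tm
  template ρ w = ƛ⊸ nest [ letter , ρ ] w (lv 0)

  regEnv : ℕ → ℕ → (Fin N → Tm) → Fin N → Tm
  regEnv d p val i = if toℕ i <ᵇ p then val i else regVar d i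

  templates : Fin s → (Fin N → Tm) → List Tm
  templates a ρ = map (template ρ ∘ upd a) (allFin N)

  stepBody : Fin s → Tm → Tm → (Fin N → Tm) → Tm
  stepBody a X K ρ = X ·⊸ K ·⊸* templates a ρ

  stepTm : Fin s → Tm
  stepTm a = ƛ⊸ ƛ⊸ ƛ⊸^ N (stepBody a (lv (suc N)) (lv N) (regVar 1))

  idTm : Tm
  idTm = ƛ⊸ lv 0

  outputTm : Tm
  outputTm = ƛ⊸^ N (lv n ·⊸ nv 0)

  body : Tm
  body = lv 0 ·⇒* stepTm ·⇒ idTm ·⊸ outputTm ·⊸* encode (εᵘ N)

  tm : Tm
  tm = ƛ⊸ ƛ⇒^ (suc g) body

  runFrom : Update g 0 N → List (Fin s) → Update g 0 N
  runFrom = foldl (λ τ a → upd a ∘ᵘ τ)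

  regIndex<N : ∀ i → regIndex i < N
  regIndex<N i = s≤s (m∸n≤m n (toℕ i))

  regIndex-reverses : ∀ {i j} → i <ᶠ j → regIndex j < regIndex i
  regIndex-reverses {j = j} i<j = ∸-monoʳ-< i<j (Fin.toℕ≤pred[n] j)

  wordTm-closed : ∀ u → LvBelow 0 (wordTm u)
  wordTm-closed u = ƛ⊸ᴸ (LvBelow-nest (λ _ → nvᴸ) (lvᴸ z<s) u)

  regTm-closed : ∀ τ i → LvBelow 0 (regTm τ i)
  regTm-closed τ i = wordTm-closed (closedWord (τ i))

  encode-closed : ∀ τ → All (LvBelow 0) (encode τ)
  encode-closed τ = Allₚ.map⁺ (All.universal (regTm-closed τ) (allFin N))

  template-closed : ∀ w → LvBelow N (template (regVar 1) w)
  template-closed w =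
    ƛ⊸ᴸ (LvBelow-nest (λ { (inj₁ _) → nvᴸ ; (inj₂ i) → lvᴸ (s<s (regIndex<N i)) }) (lvᴸ z<s) w)

  stepTm-closed : ∀ a → LvBelow 0 (stepTm a)
  stepTm-closed a =
    ƛ⊸ᴸ (ƛ⊸ᴸ (LvBelow-ƛ⊸^ N (LvBelow-·⊸* XK-closed templates-closed)))
    where
    XK-closed : LvBelow (2 + N) (lv (suc N) ·⊸ lv N)
    XK-closed = lvᴸ (n<1+n (suc N)) ·⊸ᴸ lvᴸ (m<n⇒m<1+n (n<1+n N))
    templates-closed : All (LvBelow (2 + N)) (templates a (regVar 1))
    templates-closed =
      Allₚ.map⁺ (All.universal (λ ℓ → LvBelow-mono (m≤n+m N 2) (template-closed (upd a ℓ))) (allFin N))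

  idTm-closed : LvBelow 0 idTm
  idTm-closed = ƛ⊸ᴸ (lvᴸ z<s)

  outputTm-closed : LvBelow 0 outputTm
  outputTm-closed = LvBelow-ƛ⊸^ N (lvᴸ (n<1+n n) ·⊸ᴸ nvᴸ)

  stepTm-⇒Free : ∀ a → ⇒Free (stepTm a)
  stepTm-⇒Free a = ƛ⊸ᶠ (ƛ⊸ᶠ (⇒Free-ƛ⊸^ N (⇒Free-·⊸* (lvᶠ ·⊸ᶠ lvᶠ) templates-⇒Free)))
    where
    template-⇒Free : ∀ w → ⇒Free (template (regVar 1) w)
    template-⇒Free w = ƛ⊸ᶠ (⇒Free-nest (λ { (inj₁ _) → nvᶠ ; (inj₂ _) → lvᶠ }) lvᶠ w)
    templates-⇒Free : All ⇒Free (templates a (regVar 1))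
    templates-⇒Free = Allₚ.map⁺ (All.universal (template-⇒Free ∘ upd a) (allFin N))

  wordTm-β : ∀ u z → wordTm u ·⊸ z ↦* nest letter u z
  wordTm-β u z = β⊸ ◅ ≡⇒↦* (nest-hom (substL 0 z) (λ _ _ → refl) letter u (lv 0))

  nest-instantiate : ∀ (c : Fin N → List (Fin g)) w z →
                     nest [ letter , wordTm ∘ c ] w z ↦* nest letter (instantiate c w) z
  nest-instantiate c [] z = ε
  nest-instantiate c (inj₁ x ∷ w) z = ξ*⊸ᵣ (nest-instantiate c w z)
  nest-instantiate c (inj₂ i ∷ w) z =
    ξ*⊸ᵣ (nest-instantiate c w z)
    ◅◅ wordTm-β (c i) _
    ◅◅ ≡⇒↦* (sym (nest-++ letter (c i) (instantiate c w) z))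

  template-cong : ∀ {ρ ρ'} → (∀ i → ρ i ≡ ρ' i) → ∀ w → template ρ w ≡ template ρ' w
  template-cong ρ≗ρ' w = cong ƛ⊸_ (nest-cong (λ { (inj₁ _) → refl ; (inj₂ i) → ρ≗ρ' i }) w (lv 0))

  template-substL : ∀ j {u} ρ w → LvBelow 0 u →
                    substL j u (template ρ w) ≡ template (substL (suc j) u ∘ ρ) w
  template-substL j {u} ρ w u-closed rewrite shiftL-LvBelow 0 z≤n u-closed =
    cong ƛ⊸_ (trans (nest-hom (substL (suc j) u) (λ _ _ → refl) _ w (lv 0))
                    (nest-cong (λ { (inj₁ _) → refl ; (inj₂ _) → refl }) w (lv 0)))

  substL-stepBody : ∀ j u a X K {ρ ρ'} →
    (∀ ℓ → substL j u (template ρ (upd a ℓ)) ≡ template ρ' (upd a ℓ)) →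
    substL j u (stepBody a X K ρ) ≡ stepBody a (substL j u X) (substL j u K) ρ'
  substL-stepBody j u a X K {ρ} templates≡ =
    trans (substL-·⊸* j u (X ·⊸ K) (templates a ρ))
          (cong (substL j u X ·⊸ substL j u K ·⊸*_)
                (trans (sym (map-∘ (allFin N))) (map-cong templates≡ (allFin N))))

  regEnv-step : ∀ d val → (∀ i → LvBelow 0 (val i)) → ∀ q i →
    substL (d + regIndex q) (val q) (regEnv d (toℕ q) val i) ≡ regEnv d (suc (toℕ q)) val i
  regEnv-step d val val-closed q i with <-cmp (toℕ i) (toℕ q)
  ... | tri< i<q _ _ rewrite <ᵇ-true i<q | <ᵇ-true (m<n⇒m<1+n i<q) =
    substL-LvBelow _ _ z≤n (val-closed i)
  ... | tri≈ _ i≡q _ rewrite <ᵇ-false (≤-reflexive (sym i≡q)) | <ᵇ-true (s≤s (≤-reflexive i≡q))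
                           | Fin.toℕ-injective i≡q = substL-lv≡ (d + regIndex q) (val q)
  ... | tri> _ _ q<i rewrite <ᵇ-false (<⇒≤ q<i) | <ᵇ-false q<i =
    substL-lv< (val q) (+-monoʳ-< d (regIndex-reverses q<i))

  regEnv-all : ∀ d val i → regEnv d N val i ≡ val i
  regEnv-all d val i rewrite <ᵇ-true (Fin.toℕ<n i) = refl

  -- F p is the body once the registers r₀ … r_{p-1} have been substituted.
  registers-β : (F : ℕ → Tm) (val : Fin N → Tm) → (∀ q → LvBelow 0 (val q)) →
    (∀ q → substL (regIndex q) (val q) (F (toℕ q)) ≡ F (suc (toℕ q))) →
    ƛ⊸^ N (F 0) ·⊸* map val (allFin N) ↦* F N
  registers-β F val val-closed F-step = go N 0 id (λ _ → refl) refl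
    where
    go : ∀ k p (f : Fin k → Fin N) → (∀ i → toℕ (f i) ≡ p + toℕ i) → p + k ≡ N →
         ƛ⊸^ k (F p) ·⊸* map val (tabulate f) ↦* F N
    go zero p f _ p+0≡N = ≡⇒↦* (cong F (trans (sym (+-identityʳ p)) p+0≡N))
    go (suc k) p f f-from p+k≡N =
      ξ*·⊸*ₗ (map val (tabulate (f ∘ fs)))
             (β⊸ ◅ ≡⇒↦* (trans (substL-ƛ⊸^ k 0 (F p) (val-closed q)) (cong (ƛ⊸^ k) substituted)))
      ◅◅ go k (suc p) (f ∘ fs) (λ i → trans (f-from (fs i)) (+-suc p (toℕ i)))
                               (trans (sym (+-suc p k)) p+k≡N)
      where
      q : Fin N
      q = f fz
      q≡p : toℕ q ≡ p
      q≡p = trans (f-from fz) (+-identityʳ p)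
      regIndex-q : regIndex q ≡ k
      regIndex-q = begin
        n ∸ toℕ q    ≡⟨ cong₂ _∸_ (sym (suc-injective (trans (sym (+-suc p k)) p+k≡N))) q≡p ⟩
        p + k ∸ p    ≡⟨ m+n∸m≡n p k ⟩
        k            ∎
        where open ≡-Reasoning
      substituted : substL k (val q) (F p) ≡ F (suc p)
      substituted = subst₂ (λ j x → substL j (val q) (F x) ≡ F (suc x)) regIndex-q q≡p (F-step q)

  stepTm-β : ∀ a {X K} → LvBelow 0 X → LvBelow 0 K →
             stepTm a ·⊸ X ·⊸ K ↦* ƛ⊸^ N (stepBody a X K (regVar 1))
  stepTm-β a {X} {K} X-closed K-closed = begin
      stepTm a ·⊸ X ·⊸ K
    ⟶⟨ ξ⊸ₗ β⊸ ⟩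
      substL 0 X (ƛ⊸^ (suc N) (stepBody a (lv (suc N)) (lv N) (regVar 1))) ·⊸ K
    ≡⟨ cong (_·⊸ K) (trans (substL-ƛ⊸^ (suc N) 0 _ X-closed) (cong (ƛ⊸^ (suc N)) X-substituted)) ⟩
      ƛ⊸ ƛ⊸^ N (stepBody a X (lv N) (regVar 1)) ·⊸ K
    ⟶⟨ β⊸ ⟩
      substL 0 K (ƛ⊸^ N (stepBody a X (lv N) (regVar 1)))
    ≡⟨ trans (substL-ƛ⊸^ N 0 _ K-closed) (cong (ƛ⊸^ N) K-substituted) ⟩
      ƛ⊸^ N (stepBody a X K (regVar 1)) ∎
    where
    open StarReasoning _↦_
    templates-fixed : ∀ j u → N ≤ j → ∀ ℓ →
                      substL j u (template (regVar 1) (upd a ℓ)) ≡ template (regVar 1) (upd a ℓ)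
    templates-fixed j u N≤j ℓ = substL-LvBelow j u N≤j (template-closed (upd a ℓ))
    X-substituted : substL (suc N) X (stepBody a (lv (suc N)) (lv N) (regVar 1))
                  ≡ stepBody a X (lv N) (regVar 1)
    X-substituted = trans (substL-stepBody (suc N) X a _ _ (templates-fixed (suc N) X (n≤1+n N)))
      (cong₂ (λ Y Z → stepBody a Y Z (regVar 1)) (substL-lv≡ (suc N) X) (substL-lv< X (n<1+n N)))
    K-substituted : substL N K (stepBody a X (lv N) (regVar 1)) ≡ stepBody a X K (regVar 1)
    K-substituted = trans (substL-stepBody N K a _ _ (templates-fixed N K ≤-refl))
      (cong₂ (λ Y Z → stepBody a Y Z (regVar 1)) (substL-LvBelow N K z≤n X-closed) (substL-lv≡ N K))

  template-β : ∀ τ a ℓ → template (regEnv 1 N (regTm τ)) (upd a ℓ) ↦* regTm (upd a ∘ᵘ τ) ℓ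
  template-β τ a ℓ = begin
      template (regEnv 1 N (regTm τ)) (upd a ℓ)
    ≡⟨ template-cong (regEnv-all 1 (regTm τ)) (upd a ℓ) ⟩
      template (regTm τ) (upd a ℓ)
    ⟶*⟨ ξ*ƛ⊸ (nest-instantiate (closedWord ∘ τ) (upd a ℓ) (lv 0)) ⟩
      wordTm (instantiate (closedWord ∘ τ) (upd a ℓ))
    ≡⟨ cong wordTm (sym (closedWord-∘ᵘ (upd a) τ ℓ)) ⟩
      regTm (upd a ∘ᵘ τ) ℓ ∎
    where open StarReasoning _↦_

  letters-β : ∀ v τ {K} → LvBelow 0 K →
              nest stepTm v idTm ·⊸ K ·⊸* encode τ ↦* K ·⊸* encode (runFrom τ v)
  letters-β [] τ K-closed = ξ*·⊸*ₗ (encode τ) (β⊸ ◅ ε)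
  letters-β (a ∷ v) τ {K} K-closed = begin
      stepTm a ·⊸ X ·⊸ K ·⊸* encode τ
    ⟶*⟨ ξ*·⊸*ₗ (encode τ) (stepTm-β a X-closed K-closed) ⟩
      ƛ⊸^ N (stepBody a X K (regVar 1)) ·⊸* encode τ
    ⟶*⟨ registers-β (λ p → stepBody a X K (regEnv 1 p (regTm τ))) (regTm τ) (regTm-closed τ) step ⟩
      stepBody a X K (regEnv 1 N (regTm τ))
    ⟶*⟨ ξ*·⊸*-map (X ·⊸ K) (allFin N) (template-β τ a) ⟩
      X ·⊸ K ·⊸* encode (upd a ∘ᵘ τ)
    ⟶*⟨ letters-β v (upd a ∘ᵘ τ) K-closed ⟩
      K ·⊸* encode (runFrom τ (a ∷ v)) ∎
    where
    open StarReasoning _↦_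
    X : Tm
    X = nest stepTm v idTm
    X-closed : LvBelow 0 X
    X-closed = LvBelow-nest stepTm-closed idTm-closed v
    step : ∀ q → substL (regIndex q) (regTm τ q) (stepBody a X K (regEnv 1 (toℕ q) (regTm τ)))
               ≡ stepBody a X K (regEnv 1 (suc (toℕ q)) (regTm τ))
    step q = trans (substL-stepBody _ _ a X K (λ ℓ →
        trans (template-substL _ _ (upd a ℓ) (regTm-closed τ q))
              (template-cong (regEnv-step 1 (regTm τ) (regTm-closed τ) q) (upd a ℓ))))
      (cong₂ (λ Y Z → stepBody a Y Z _) (substL-LvBelow _ _ z≤n X-closed) (substL-LvBelow _ _ z≤n K-closed))

  output-β : ∀ τ → outputTm ·⊸* encode τ ↦* nest letter (closedWord (τ fz)) (nv 0)
  output-β τ =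
    registers-β (λ p → regEnv 0 p (regTm τ) fz ·⊸ nv 0) (regTm τ) (regTm-closed τ)
      (λ q → cong (_·⊸ nv 0) (regEnv-step 0 (regTm τ) (regTm-closed τ) q fz))
    ◅◅ wordTm-β (closedWord (τ fz)) (nv 0)

  tm-β : ∀ w → tm ·⊸ church s w ↦* church g ⟦ w ⟧
  tm-β w = begin
      tm ·⊸ church s w
    ⟶⟨ β⊸ ⟩
      substL 0 (church s w) (ƛ⇒^ (suc g) body)
    ≡⟨ trans (substL-ƛ⇒^ (suc g) 0 body (church-closed s w)) (cong (ƛ⇒^ (suc g)) body-substituted) ⟩
      ƛ⇒^ (suc g) (church s w ·⇒* stepTm ·⇒ idTm ·⊸ outputTm ·⊸* encode (εᵘ N))
    ⟶*⟨ ξ*ƛ⇒^ (suc g) (ξ*·⊸*ₗ (encode (εᵘ N)) (ξ*⊸ₗ (church-·⇒*-β stepTm stepTm-⇒Free w idTm))) ⟩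
      ƛ⇒^ (suc g) (nest stepTm w idTm ·⊸ outputTm ·⊸* encode (εᵘ N))
    ⟶*⟨ ξ*ƛ⇒^ (suc g) (letters-β w (εᵘ N) outputTm-closed) ⟩
      ƛ⇒^ (suc g) (outputTm ·⊸* encode (run w))
    ⟶*⟨ ξ*ƛ⇒^ (suc g) (output-β (run w)) ⟩
      church g ⟦ w ⟧ ∎
    where
    open StarReasoning _↦_
    ch : Tm
    ch = church s w
    body-substituted : substL 0 ch body ≡ ch ·⇒* stepTm ·⇒ idTm ·⊸ outputTm ·⊸* encode (εᵘ N)
    body-substituted = trans (substL-·⊸* 0 ch _ (encode (εᵘ N)))
      (cong₂ _·⊸*_ (cong₂ _·⊸_ (cong₂ _·⇒_ (substL-·⇒* 0 ch (lv 0) stepTm stepTm-closed)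
                                           (substL-LvBelow 0 ch z≤n idTm-closed))
                               (substL-LvBelow 0 ch z≤n outputTm-closed))
                   (map-substL-LvBelow 0 ch z≤n (encode-closed (εᵘ N))))

  K : Ty
  K = endos N o

  κ : Ty
  κ = K ⊸ K

  κ-purelyAffine : PurelyAffine κ
  κ-purelyAffine = ⊸-pa (PurelyAffine-endos N o-pa) (PurelyAffine-endos N o-pa)

  Ψ₀ : List Ty
  Ψ₀ = o ∷ replicate g Endo ++ []

  ∋-letter : ∀ (c : Fin g) → Ψ₀ ∋ g ∸ toℕ c ⦂ Endo
  ∋-letter c with g ∸ toℕ c | m<n⇒0<n∸m (Fin.toℕ<n c) | m∸n≤m g (toℕ c)
  ... | zero | () | _
  ... | suc k | _ | k<g = there (∋-replicate g k<g)

  usage : List (Fin g ⊎ Fin N) → List ℕ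
  usage w = map regIndex (registers w)

  Decreasing-usage : ∀ {L} → AllPairs _<ᶠ_ L → Decreasing (map regIndex L)
  Decreasing-usage L↑ = AllPairsₚ.map⁺ (AllPairs.map regIndex-reverses L↑)

  usage<N : ∀ L → All (_< N) (map regIndex L)
  usage<N L = Allₚ.map⁺ (All.universal regIndex<N L)

  ⊢template : ∀ {Δ} w → Decreasing (usage w) →
              Ψ₀ ∣ (replicate N Endo ++ Δ) ⊢ template (regVar 1) w ⦂ Endo ▷ usage w
  ⊢template w dec = ⊢-cast▷ (unbind-suc-0 (usage w)) (⊢ƛ⊸ (⊢nest w (Decreasing-suc-0 dec)))
    where
    ⊢nest : ∀ {Δ} w → Decreasing (map suc (usage w) ++ (0 ∷ [])) →
      Ψ₀ ∣ (o ∷ replicate N Endo ++ Δ) ⊢ nest [ letter , regVar 1 ] w (lv 0) ⦂ o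
         ▷ (map suc (usage w) ++ (0 ∷ []))
    ⊢nest [] _ = ⊢lv here
    ⊢nest (inj₁ c ∷ w) dec = ⊢·⊸ (⊢nv (∋-letter c)) (⊢nest w dec) (AllPairs⇒Linked dec)
    ⊢nest (inj₂ i ∷ w) dec@(_ ∷ dec') =
      ⊢·⊸ (⊢lv (there (∋-replicate N (regIndex<N i)))) (⊢nest w dec') (AllPairs⇒Linked dec)

  ⊢stepTm : ∀ {Δ} a → Ψ₀ ∣ Δ ⊢ stepTm a ⦂ κ ⊸ κ ▷ []
  ⊢stepTm {Δ} a = ⊢-cast▷ (unbind^-[] (2 + N) bounded) (⊢ƛ⊸ (⊢ƛ⊸ (⊢ƛ⊸^ N ⊢stepBody)))
    where
    open RegisterOrder (upd a) (copyless a) (monotone a)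
    all-usage : List ℕ
    all-usage = concatMap (usage ∘ upd a) (allFin N)
    all-usage≡ : all-usage ≡ map regIndex (concatMap (registers ∘ upd a) (allFin N))
    all-usage≡ = trans (cong concat (map-∘ (allFin N))) (concat-map (map (registers ∘ upd a) (allFin N)))
    all-usage<N : All (_< N) all-usage
    all-usage<N = subst (All (_< N)) (sym all-usage≡) (usage<N _)
    decreasing : Decreasing (suc N ∷ N ∷ all-usage)
    decreasing = (n<1+n N ∷ All.map m<n⇒m<1+n all-usage<N) ∷ all-usage<N
               ∷ subst Decreasing (sym all-usage≡) (Decreasing-usage all-registers-increasing)
    bounded : All (_< 2 + N) (suc N ∷ N ∷ all-usage)
    bounded = n<1+n (suc N) ∷ m<n⇒m<1+n (n<1+n N) ∷ All.map (m<n⇒m<1+n ∘ m<n⇒m<1+n) all-usage<N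
    ⊢stepBody : Ψ₀ ∣ (replicate N Endo ++ K ∷ κ ∷ Δ) ⊢ stepBody a (lv (suc N)) (lv N) (regVar 1) ⦂ o
                ▷ (suc N ∷ N ∷ all-usage)
    ⊢stepBody = ⊢·⊸*-map (template (regVar 1) ∘ upd a) (usage ∘ upd a) (allFin N) (length-tabulate id)
      (⊢·⊸ (⊢lv (∋-replicate-++ N (there here))) (⊢lv (∋-replicate-++ N here)) (n<1+n N ∷ [-]))
      (λ ℓ → ⊢template (upd a ℓ) (Decreasing-usage (registers-increasing ℓ)))
      decreasing

  ⊢outputTm : ∀ {Δ} → Ψ₀ ∣ Δ ⊢ outputTm ⦂ K ▷ []
  ⊢outputTm = ⊢-cast▷ (unbind^-[] N (n<1+n n ∷ []))
    (⊢ƛ⊸^ N (⊢·⊸ (⊢lv (∋-replicate N (n<1+n n))) (⊢nv here) [-]))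

  ⊢body : Ψ₀ ∣ (Str s [ κ ]ᵀ ∷ []) ⊢ body ⦂ o ▷ (0 ∷ [])
  ⊢body = ⊢-cast▷ (cong (0 ∷_) (no-usage (allFin N)))
    (⊢·⊸*-map (regTm (εᵘ N)) (λ _ → []) (allFin N) (length-tabulate id)
      (⊢·⊸ (⊢·⇒ (⊢·⇒* κ stepTm (⊢lv here) ⊢stepTm) (⊢ƛ⊸ (⊢lv here))) ⊢outputTm [-])
      (λ _ → ⊢ƛ⊸ (⊢lv here))
      (subst (λ U → Decreasing (0 ∷ U)) (sym (no-usage (allFin N))) ([] ∷ [])))
    where
    no-usage : ∀ {A : Set} (xs : List A) → concatMap {B = ℕ} (λ _ → []) xs ≡ []
    no-usage [] = refl
    no-usage (_ ∷ xs) = no-usage xs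

  ⊢tm : [] ∣ [] ⊢ tm ⦂ Str s [ κ ]ᵀ ⊸ Str g ▷ []
  ⊢tm = ⊢ƛ⊸ (⊢ƛ⇒^ g [] ⊢body)

lemma4p12 : ∀ (s g : ℕ) (T : MRT s g) → AffineDefinable s g (MRT.⟦_⟧ T)
lemma4p12 s g T = κ , κ-purelyAffine , tm , ⊢tm , ↦*⇒=βη ∘ tm-β
  where open Encoding T
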